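{- For a positive integer $n$, let $P(n)$ be the largest size of a set of permutations of $[n]=\{1,\dots,n\}$ any two distinct members of which are locally parallel. Then $$\frac{n!}{6^n}<P(n)\le \frac{n!}{6^{\lfloor n/3\rfloor}}.$$
   Context: A permutation of $[n]$ is a bijection $[n]\to[n]$; for a permutation $\sigma$ and $a\in[n]$, $\sigma^{ -1}(a)$ is the position of $a$ when $\sigma$ is viewed as the linear order $\sigma(1),\dots,\sigma(n)$. Two permutations $\sigma,\tau$ of $[n]$ are called locally parallel if there exist two distinct elements $a,b\in[n]$ such that $\sigma^{ -1}(a)<\sigma^{ -1}(b)$, $\tau^{ -1}(b)<\tau^{ -1}(a)$, and $[\sigma^{ -1}(a),\sigma^{ -1}(b)]\cap[\tau^{ -1}(b),\tau^{ -1}(a)]=\emptyset$ (intervals of integers/positions). -}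

module Defs where

open import Data.Nat using (ℕ; _≤_)
open import Data.Fin using (Fin) renaming (_<_ to _<ᶠ_; _≤_ to _≤ᶠ_)
open import Data.Fin.Permutation using (Permutation′; _⟨$⟩ʳ_; _⟨$⟩ˡ_)
open import Data.List using (List; length)
open import Data.List.Relation.Unary.AllPairs using (AllPairs)
open import Data.Product using (Σ; ∃; _×_)
open import Relation.Binary.PropositionalEquality using (_≡_; _≢_)
open import Relation.Nullary using (¬_)

-- Position of a in σ (σ viewed as the linear order σ(1),…,σ(n)): σ⁻¹(a).
pos : ∀ {n} → Permutation′ n → Fin n → Fin n
pos σ a = σ ⟨$⟩ˡ a

DisjointIntervals : ∀ {n} → Fin n → Fin n → Fin n → Fin n → Set
DisjointIntervals {n} p q r s = ¬ (Σ (Fin n) λ k → (p ≤ᶠ k × k ≤ᶠ q) × (r ≤ᶠ k × k ≤ᶠ s))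

LocallyParallel : ∀ {n} → Permutation′ n → Permutation′ n → Set
LocallyParallel {n} σ τ =
  Σ (Fin n) λ a → Σ (Fin n) λ b →
    a ≢ b × pos σ a <ᶠ pos σ b × pos τ b <ᶠ pos τ a
    × DisjointIntervals (pos σ a) (pos σ b) (pos τ b) (pos τ a)

Distinct : ∀ {n} → Permutation′ n → Permutation′ n → Set
Distinct σ τ = ∃ λ i → σ ⟨$⟩ʳ i ≢ τ ⟨$⟩ʳ i

-- A set of permutations (given as a list of pairwise distinct members)
-- any two distinct members of which are locally parallel.
LPFamily : (n : ℕ) → List (Permutation′ n) → Set
LPFamily n S = AllPairs (λ σ τ → Distinct σ τ × LocallyParallel σ τ) S

IsP : ℕ → ℕ → Set
IsP n p = (∃ λ S → LPFamily n S × length S ≡ p)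
        × (∀ S → LPFamily n S → length S ≤ p)

module Submission where

-- The family size P(n) exists because there are finitely many permutations: it is the
-- clique number of the graph "distinct and locally parallel" on the n! codes of permutations.
--
-- Group the first 3⌊n/3⌋ positions into consecutive triples and let B be the
-- 6^⌊n/3⌋ permutations of positions inside the triples. If σ ∘ β = τ ∘ β′ for β, β′ ∈ B then
-- every element has its σ- and τ-positions in the same triple, and two position intervals
-- of length at least two inside a window of three positions meet; so σ and τ are not locally
-- parallel. Hence the sets {σ ∘ β : β ∈ B} for the members σ of a family are pairwise disjoint.
--
-- In a maximum family S every τ fails to be locally parallel to some σ ∈ S,
-- which says that ω = σ⁻¹ ∘ τ satisfies ω j ≤ j and i ≤ ω i for each inversion i < j,
-- ω j < ω i. Such an ω is determined, position by position from the left, by marking each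
-- position as fixed point, left-to-right maximum or neither, and each value by whether it
-- sits at a left-to-right maximum; there are at most 4 · 6^(n-1) such markings, so
-- n! ≤ |S| · 4 · 6^(n-1) < |S| · 6^n.

open import Defs
open import Data.Nat using (ℕ; zero; suc; _+_; _*_; _^_; _!; _⊔_; _≤_; _<_; z≤n; s≤s; NonZero)
import Data.Nat.Properties as ℕ
open import Data.Nat.DivMod using (_/_; m/n*n≤m)
open import Data.Bool using (Bool; true; false)
open import Data.Empty using (⊥; ⊥-elim)
open import Data.Unit using (⊤; tt)
open import Data.Product using (Σ; ∃; _×_; _,_; proj₁; proj₂; uncurry)
open import Data.Sum as Sum using (inj₁; inj₂)
open import Data.Sum.Function.Propositional using (_⊎-↔_)
open import Data.Fin
  using (Fin; zero; suc; toℕ; combine; remQuot; quotient; remainder; punchIn; join; _↑ˡ_; _↑ʳ_;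
         funToFin; finToFun)
  renaming (_<_ to _<ᶠ_; _≤_ to _≤ᶠ_)
open import Data.Fin.Patterns using (0F; 1F; 2F; 3F; 4F; 5F)
open import Data.Fin.Properties
  using (_≟_; _<?_; _≤?_; any?; all?; ¬∀⟶∃¬; <-cmp; <-asym; <⇒≢; toℕ-injective; injective⇒≤;
         combine-remQuot; remQuot-combine; combine-injectiveˡ; combine-injectiveʳ; punchIn-injective;
         splitAt-↑ˡ; splitAt-↑ʳ; ↑ˡ-injective; ↑ʳ-injective; +↔⊎; funToFin-finToFin; finToFun-funToFin)
open import Data.Fin.Induction using (<-wellFounded)
open import Data.Fin.Permutation
  using (Permutation′; _⟨$⟩ʳ_; _⟨$⟩ˡ_; _≈_; _∘ₚ_; flip; id; insert; remove; inverseˡ; inverseʳ;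
         insert-punchIn; insert-remove)
open import Data.List using (List; []; _∷_; length; map; lookup)
open import Data.List.Properties using (length-map)
open import Data.List.Membership.Propositional using (_∈_; _∉_)
open import Data.List.Membership.Propositional.Properties using (∈-lookup)
open import Data.List.Relation.Unary.Any as Any using (Any; here; there; index)
open import Data.List.Relation.Unary.Any.Properties using (lookup-index)
open import Data.List.Relation.Unary.All as All using (All; []; _∷_)
import Data.List.Relation.Unary.All.Properties as All
open import Data.List.Relation.Unary.AllPairs as AllPairs using (AllPairs; []; _∷_)
import Data.List.Relation.Unary.AllPairs.Properties as AllPairs
open import Function using (_∘_; _on_)
open import Function.Properties.Inverse using (↔-trans; ↔-sym)
import Induction.WellFounded as WF
open import Level using (0ℓ)
open import Relation.Binary.Core using (Rel)
open import Relation.Binary.Definitions using (Symmetric; Decidable; tri<; tri≈; tri>)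
open import Relation.Binary.PropositionalEquality
open import Relation.Nullary using (¬_; Dec; yes; no; contradiction)
open import Relation.Nullary.Decidable using (_×-dec_; _→-dec_; ¬?; map′; decidable-stable)
open import Relation.Unary using (Pred)
import Relation.Unary as Unary

-- Enumerating permutations

pos-cong : ∀ {n} {σ τ : Permutation′ n} → σ ≈ τ → ∀ a → pos σ a ≡ pos τ a
pos-cong {σ = σ} {τ} σ≈τ a =
  trans (sym (inverseˡ τ)) (cong (τ ⟨$⟩ˡ_) (trans (sym (σ≈τ _)) (inverseʳ σ)))

⟨$⟩ʳ-injective : ∀ {n} (π : Permutation′ n) {x y} → π ⟨$⟩ʳ x ≡ π ⟨$⟩ʳ y → x ≡ y
⟨$⟩ʳ-injective π eq = trans (sym (inverseˡ π)) (trans (cong (π ⟨$⟩ˡ_) eq) (inverseˡ π))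

insert-cong : ∀ {n} {π ρ : Permutation′ n} (j : Fin (suc n)) → π ≈ ρ → insert zero j π ≈ insert zero j ρ
insert-cong j π≈ρ zero    = refl
insert-cong {π = π} {ρ} j π≈ρ (suc k) = begin
  insert zero j π ⟨$⟩ʳ suc k ≡⟨ insert-punchIn zero j π k ⟩
  punchIn j (π ⟨$⟩ʳ k)       ≡⟨ cong (punchIn j) (π≈ρ k) ⟩
  punchIn j (ρ ⟨$⟩ʳ k)       ≡⟨ insert-punchIn zero j ρ k ⟨
  insert zero j ρ ⟨$⟩ʳ suc k ∎
  where open ≡-Reasoning

remQuot-injective : ∀ {m} n {x y : Fin (m * n)} → remQuot {m} n x ≡ remQuot {m} n y → x ≡ y
remQuot-injective {m} n {x} {y} eq = begin
  x                                  ≡⟨ combine-remQuot {m} n x ⟨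
  uncurry combine (remQuot {m} n x)  ≡⟨ cong (uncurry combine) eq ⟩
  uncurry combine (remQuot {m} n y)  ≡⟨ combine-remQuot {m} n y ⟩
  y                                  ∎
  where open ≡-Reasoning

funToFin-cong : ∀ {m n} {f g : Fin m → Fin n} → (∀ i → f i ≡ g i) → funToFin f ≡ funToFin g
funToFin-cong {zero}  _   = refl
funToFin-cong {suc m} f≗g = cong₂ combine (f≗g zero) (funToFin-cong (f≗g ∘ suc))

finToFun-injective : ∀ {m n} {c d : Fin (m ^ n)} → (∀ i → finToFun {m} {n} c i ≡ finToFun d i) → c ≡ d
finToFun-injective {m} {n} {c} {d} eq =
  trans (sym (funToFin-finToFin {n} {m} c)) (trans (funToFin-cong {n} {m} eq) (funToFin-finToFin {n} {m} d))

toCode : ∀ {n} → Permutation′ n → Fin (n !)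
toCode {zero}  σ = zero
toCode {suc n} σ = combine (σ ⟨$⟩ʳ zero) (toCode (remove zero σ))

fromCode : ∀ n → Fin (n !) → Permutation′ n
fromCode zero    c = id
fromCode (suc n) c = insert zero (quotient (n !) c) (fromCode n (remainder {suc n} (n !) c))

fromCode-toCode : ∀ {n} (σ : Permutation′ n) → fromCode n (toCode σ) ≈ σ
fromCode-toCode {zero}  σ ()
fromCode-toCode {suc n} σ k = begin
  fromCode (suc n) (toCode σ) ⟨$⟩ʳ k
    ≡⟨ cong (λ (q , r) → insert zero q (fromCode n r) ⟨$⟩ʳ k) (remQuot-combine (σ ⟨$⟩ʳ zero) _) ⟩
  insert zero (σ ⟨$⟩ʳ zero) (fromCode n (toCode (remove zero σ))) ⟨$⟩ʳ k
    ≡⟨ insert-cong (σ ⟨$⟩ʳ zero) (fromCode-toCode (remove zero σ)) k ⟩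
  insert zero (σ ⟨$⟩ʳ zero) (remove zero σ) ⟨$⟩ʳ k
    ≡⟨ insert-remove zero σ k ⟩
  σ ⟨$⟩ʳ k ∎
  where open ≡-Reasoning

fromCode-injective : ∀ {n} {c d : Fin (n !)} → fromCode n c ≈ fromCode n d → c ≡ d
fromCode-injective {zero}  {zero} {zero} _ = refl
fromCode-injective {suc n} {c}    {d}    eq =
  remQuot-injective {suc n} (n !) (cong₂ _,_ (eq zero) (fromCode-injective rem-eq))
  where
  open ≡-Reasoning
  quot = quotient {suc n} (n !)
  rem  = remainder {suc n} (n !)
  rem-eq : fromCode n (rem c) ≈ fromCode n (rem d)
  rem-eq k = punchIn-injective (quot c) _ _ (begin
    punchIn (quot c) (fromCode n (rem c) ⟨$⟩ʳ k) ≡⟨ insert-punchIn zero (quot c) (fromCode n (rem c)) k ⟨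
    fromCode (suc n) c ⟨$⟩ʳ suc k                ≡⟨ eq (suc k) ⟩
    fromCode (suc n) d ⟨$⟩ʳ suc k                ≡⟨ insert-punchIn zero (quot d) (fromCode n (rem d)) k ⟩
    punchIn (quot d) (fromCode n (rem d) ⟨$⟩ʳ k) ≡⟨ cong (λ j → punchIn j (fromCode n (rem d) ⟨$⟩ʳ k)) (eq zero) ⟨
    punchIn (quot c) (fromCode n (rem d) ⟨$⟩ʳ k) ∎)

toCode-injective : ∀ {n} {σ τ : Permutation′ n} → toCode σ ≡ toCode τ → σ ≈ τ
toCode-injective {σ = σ} {τ} eq i =
  trans (sym (fromCode-toCode σ i)) (trans (cong (λ c → fromCode _ c ⟨$⟩ʳ i) eq) (fromCode-toCode τ i))

injective⇒≤! : ∀ {m n} (f : Fin m → Permutation′ n) → (∀ {i j} → f i ≈ f j → i ≡ j) → m ≤ n !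
injective⇒≤! f inj = injective⇒≤ {f = toCode ∘ f} (inj ∘ toCode-injective)

injective⇒!≤ : ∀ {m n} (g : Permutation′ n → Fin m) → (∀ {σ τ} → g σ ≡ g τ → σ ≈ τ) → n ! ≤ m
injective⇒!≤ {n = n} g inj = injective⇒≤ {f = g ∘ fromCode n} (fromCode-injective ∘ inj)

-- Maximum cliques

IsMaxLength : ∀ {A : Set} → (List A → Set) → ℕ → Set
IsMaxLength P p = (∃ λ xs → P xs × length xs ≡ p) × (∀ xs → P xs → length xs ≤ p)

IsMaxLength-map : ∀ {A B : Set} {P : List A → Set} {Q : List B → Set} {p} (f : A → B) (g : B → A) →
  (∀ {xs} → P xs → Q (map f xs)) → (∀ {ys} → Q ys → P (map g ys)) →
  IsMaxLength Q p → IsMaxLength P p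
IsMaxLength-map f g P⇒Q Q⇒P ((ys , qys , refl) , bound) =
  (map g ys , Q⇒P qys , length-map g ys) ,
  λ xs pxs → subst (_≤ _) (length-map f xs) (bound (map f xs) (P⇒Q pxs))

AllPairs-lookup : ∀ {A : Set} {R : Rel A 0ℓ} → Symmetric R → ∀ {xs} → AllPairs R xs →
  ∀ {i j} → i ≢ j → R (lookup xs i) (lookup xs j)
AllPairs-lookup R-sym (px ∷ pxs) {zero}  {zero}  i≢j = contradiction refl i≢j
AllPairs-lookup R-sym (px ∷ pxs) {zero}  {suc j} _   = All.lookup px (∈-lookup j)
AllPairs-lookup R-sym (px ∷ pxs) {suc i} {zero}  _   = R-sym (All.lookup px (∈-lookup i))
AllPairs-lookup R-sym (px ∷ pxs) {suc i} {suc j} i≢j = AllPairs-lookup R-sym pxs (i≢j ∘ cong suc)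

CliqueIn : ∀ {N} → Pred (Fin N) 0ℓ → Rel (Fin N) 0ℓ → List (Fin N) → Set
CliqueIn U Q xs = All U xs × AllPairs Q xs

module _ {N : ℕ} where

  strip : List (Fin (suc N)) → List (Fin N)
  strip []           = []
  strip (zero  ∷ xs) = strip xs
  strip (suc x ∷ xs) = x ∷ strip xs

  private
    All-strip : ∀ {P : Pred (Fin (suc N)) 0ℓ} {xs} → All P xs → All (P ∘ suc) (strip xs)
    All-strip {xs = []}         []         = []
    All-strip {xs = zero  ∷ xs} (_  ∷ pxs) = All-strip pxs
    All-strip {xs = suc x ∷ xs} (px ∷ pxs) = px ∷ All-strip pxs

  strip-clique : ∀ {U Q xs} → CliqueIn U Q xs → CliqueIn (U ∘ suc) (Q on suc) (strip xs)
  strip-clique {xs = []}         _                 = [] , []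
  strip-clique {xs = zero  ∷ xs} (_ ∷ us , _ ∷ qs) = strip-clique (us , qs)
  strip-clique {xs = suc x ∷ xs} (u ∷ us , q ∷ qs) =
    let us′ , qs′ = strip-clique (us , qs) in u ∷ us′ , All-strip q ∷ qs′

  length-strip-∉ : ∀ {xs} → zero ∉ xs → length (strip xs) ≡ length xs
  length-strip-∉ {[]}         _   = refl
  length-strip-∉ {zero  ∷ xs} z∉ = contradiction (here refl) z∉
  length-strip-∉ {suc x ∷ xs} z∉ = cong suc (length-strip-∉ (z∉ ∘ there))

  strip-∈ : ∀ {Q : Rel (Fin (suc N)) 0ℓ} → Symmetric Q → (∀ {i} → ¬ Q i i) → ∀ {xs} → AllPairs Q xs →
    zero ∈ xs → All (Q zero ∘ suc) (strip xs) × length xs ≡ suc (length (strip xs))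
  strip-∈ Q-sym Q-irr {zero ∷ xs}  (qs ∷ _)  (here refl) =
    All-strip qs , cong suc (sym (length-strip-∉ (Q-irr ∘ All.lookup qs)))
  strip-∈ Q-sym Q-irr {zero ∷ xs}  (qs ∷ _)  (there z∈) = contradiction (All.lookup qs z∈) Q-irr
  strip-∈ Q-sym Q-irr {suc x ∷ xs} (qs ∷ ps) (there z∈) =
    let qs′ , len = strip-∈ Q-sym Q-irr ps z∈ in Q-sym (All.lookup qs z∈) ∷ qs′ , cong suc len

  lift-clique : ∀ {U : Pred (Fin (suc N)) 0ℓ} {Q : Rel (Fin (suc N)) 0ℓ} {ys} →
    CliqueIn (U ∘ suc) (Q on suc) ys → CliqueIn U Q (map suc ys)
  lift-clique (us , qs) = All.map⁺ us , AllPairs.map⁺ qs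

-- Cliques avoiding vertex 0 live in the graph on the other vertices; cliques through 0
-- are 0 followed by a clique among its neighbours.
maxCliqueIn : ∀ N {U : Pred (Fin N) 0ℓ} {Q : Rel (Fin N) 0ℓ} → Unary.Decidable U → Decidable Q →
  Symmetric Q → (∀ {i} → ¬ Q i i) → ∃ (IsMaxLength (CliqueIn U Q))
maxCliqueIn zero _ _ _ _ = 0 , ([] , ([] , []) , refl) , λ { [] _ → z≤n }
maxCliqueIn (suc N) {U} {Q} U? Q? Q-sym Q-irr
  with maxCliqueIn N (U? ∘ suc) (λ i j → Q? (suc i) (suc j)) Q-sym Q-irr
     | maxCliqueIn N (λ j → U? (suc j) ×-dec Q? zero (suc j)) (λ i j → Q? (suc i) (suc j)) Q-sym Q-irr
     | U? zero
... | _ , (ys , c , refl) , bound | _ | no ¬u₀ =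
  length ys , (map suc ys , lift-clique c , length-map suc ys) , maximal
  where
  maximal : ∀ xs → CliqueIn U Q xs → length xs ≤ length ys
  maximal xs cx with Any.any? (zero ≟_) xs
  ... | yes z∈ = contradiction (All.lookup (proj₁ cx) z∈) ¬u₀
  ... | no  z∉ = subst (_≤ _) (length-strip-∉ z∉) (bound _ (strip-clique cx))
... | _ , (ys , c , refl) , bound | _ , (zs , d , refl) , bound′ | yes u₀ =
  length ys ⊔ suc (length zs) , longer , maximal
  where
  through-zero : CliqueIn U Q (zero ∷ map suc zs)
  through-zero = u₀ ∷ All.map⁺ (All.map proj₁ (proj₁ d)) ,
                 All.map⁺ (All.map proj₂ (proj₁ d)) ∷ AllPairs.map⁺ (proj₂ d)
  longer : ∃ λ xs → CliqueIn U Q xs × length xs ≡ length ys ⊔ suc (length zs)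
  longer with ℕ.≤-total (length ys) (suc (length zs))
  ... | inj₁ ys≤ = zero ∷ map suc zs , through-zero , trans (cong suc (length-map suc zs)) (sym (ℕ.m≤n⇒m⊔n≡n ys≤))
  ... | inj₂ ys≥ = map suc ys , lift-clique c , trans (length-map suc ys) (sym (ℕ.m≥n⇒m⊔n≡m ys≥))
  maximal : ∀ xs → CliqueIn U Q xs → length xs ≤ length ys ⊔ suc (length zs)
  maximal xs cx@(us , qs) with Any.any? (zero ≟_) xs
  ... | no  z∉ = ℕ.≤-trans (subst (_≤ _) (length-strip-∉ z∉) (bound _ (strip-clique cx))) (ℕ.m≤m⊔n _ _)
  ... | yes z∈ =
    let us′ , qs′ = strip-clique cx
        qs₀ , len = strip-∈ Q-sym Q-irr qs z∈
    in ℕ.≤-trans (ℕ.≤-reflexive len) (ℕ.≤-trans (s≤s (bound′ _ (All.zip (us′ , qs₀) , qs′))) (ℕ.m≤n⊔m _ _))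

DistinctLP : ∀ {n} → Rel (Permutation′ n) 0ℓ
DistinctLP σ τ = Distinct σ τ × LocallyParallel σ τ

DisjointIntervals? : ∀ {n} (p q r s : Fin n) → Dec (DisjointIntervals p q r s)
DisjointIntervals? p q r s = ¬? (any? λ k → ((p ≤? k) ×-dec (k ≤? q)) ×-dec ((r ≤? k) ×-dec (k ≤? s)))

LocallyParallel? : ∀ {n} (σ τ : Permutation′ n) → Dec (LocallyParallel σ τ)
LocallyParallel? σ τ = any? λ a → any? λ b →
  ¬? (a ≟ b) ×-dec (pos σ a <? pos σ b) ×-dec (pos τ b <? pos τ a) ×-dec
  DisjointIntervals? (pos σ a) (pos σ b) (pos τ b) (pos τ a)

LocallyParallel-sym : ∀ {n} (σ τ : Permutation′ n) → LocallyParallel σ τ → LocallyParallel τ σ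
LocallyParallel-sym σ τ (a , b , a≢b , σ-ab , τ-ba , disjoint) =
  b , a , a≢b ∘ sym , τ-ba , σ-ab , λ (k , k∈ , k∈′) → disjoint (k , k∈′ , k∈)

LocallyParallel-irrefl : ∀ {n} (σ : Permutation′ n) → ¬ LocallyParallel σ σ
LocallyParallel-irrefl σ (_ , _ , _ , σ-ab , σ-ba , _) = <-asym σ-ab σ-ba

LocallyParallel-resp-≈ : ∀ {n} {σ σ′ τ τ′ : Permutation′ n} → σ ≈ σ′ → τ ≈ τ′ →
  LocallyParallel σ τ → LocallyParallel σ′ τ′
LocallyParallel-resp-≈ {σ = σ} {σ′} {τ} {τ′} σ≈ τ≈ (a , b , a≢b , σ-ab , τ-ba , disjoint)
  rewrite pos-cong {σ = σ} {σ′} σ≈ a | pos-cong {σ = σ} {σ′} σ≈ b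
        | pos-cong {σ = τ} {τ′} τ≈ a | pos-cong {σ = τ} {τ′} τ≈ b =
  a , b , a≢b , σ-ab , τ-ba , disjoint

LocallyParallel⇒Distinct : ∀ {n} (σ τ : Permutation′ n) → LocallyParallel σ τ → Distinct σ τ
LocallyParallel⇒Distinct σ τ lp with any? (λ i → ¬? (σ ⟨$⟩ʳ i ≟ τ ⟨$⟩ʳ i))
... | yes distinct = distinct
... | no  ¬distinct = contradiction (LocallyParallel-resp-≈ {σ = σ} {τ} {τ} {τ} σ≈τ (λ _ → refl) lp) (LocallyParallel-irrefl τ)
  where
  σ≈τ : σ ≈ τ
  σ≈τ i = decidable-stable (σ ⟨$⟩ʳ i ≟ τ ⟨$⟩ʳ i) (λ ≢ → ¬distinct (i , ≢))

LocallyParallel⇒DistinctLP : ∀ {n} (σ τ : Permutation′ n) → LocallyParallel σ τ → DistinctLP σ τ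
LocallyParallel⇒DistinctLP σ τ lp = LocallyParallel⇒Distinct σ τ lp , lp

DistinctLP? : ∀ {n} (σ τ : Permutation′ n) → Dec (DistinctLP σ τ)
DistinctLP? σ τ = map′ (LocallyParallel⇒DistinctLP σ τ) proj₂ (LocallyParallel? σ τ)

DistinctLP-sym : ∀ {n} → Symmetric (DistinctLP {n})
DistinctLP-sym {_} {σ} {τ} = LocallyParallel⇒DistinctLP τ σ ∘ LocallyParallel-sym σ τ ∘ proj₂

maximumLPFamily : ∀ n → ∃ (IsP n)
maximumLPFamily n with maxCliqueIn (n !) {U = λ _ → ⊤} (λ _ → yes tt)
                        (λ c d → DistinctLP? (fromCode n c) (fromCode n d))
                        (λ {c} {d} → DistinctLP-sym {_} {fromCode n c} {fromCode n d})
                        (λ {c} → LocallyParallel-irrefl (fromCode n c) ∘ proj₂)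
... | p , maximum = p , IsMaxLength-map toCode (fromCode n) toCodes (AllPairs.map⁺ ∘ proj₂) maximum
  where
  toCodes : ∀ {S} → LPFamily n S → CliqueIn _ (DistinctLP on fromCode n) (map toCode S)
  toCodes {S} family = All.universal _ _ , AllPairs.map⁺ (AllPairs.map recode family)
    where
    recode : ∀ {σ τ} → DistinctLP σ τ → DistinctLP (fromCode n (toCode σ)) (fromCode n (toCode τ))
    recode {σ} {τ} = LocallyParallel⇒DistinctLP σ′ τ′
      ∘ LocallyParallel-resp-≈ {σ = σ} {σ′} {τ} {τ′} (sym ∘ fromCode-toCode σ) (sym ∘ fromCode-toCode τ) ∘ proj₂
      where σ′ = fromCode n (toCode σ)
            τ′ = fromCode n (toCode τ)

maximum⇒dominating : ∀ {n} {S : List (Permutation′ n)} → LPFamily n S →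
  (∀ S′ → LPFamily n S′ → length S′ ≤ length S) → ∀ τ → Any (λ σ → ¬ LocallyParallel τ σ) S
maximum⇒dominating {S = S} family maximal τ =
  Any.map (λ {σ} → _∘ LocallyParallel⇒DistinctLP τ σ)
    (All.¬All⇒Any¬ (DistinctLP? τ) S (λ all → ℕ.1+n≰n (maximal (τ ∷ S) (all ∷ family))))

-- The upper bound: permuting positions within triples

-- Positions 0, …, 3k-1 form k consecutive triples, later positions are singletons;
-- blockStart k i is the first position of the block containing i.
blockStart : ℕ → ℕ → ℕ
blockStart zero    i                   = i
blockStart (suc k) (suc (suc (suc i))) = 3 + blockStart k i
blockStart (suc k) _                   = 0

blockStart-≤ : ∀ k i → blockStart k i ≤ i
blockStart-≤ zero    i                   = ℕ.≤-refl
blockStart-≤ (suc k) 0                   = z≤n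
blockStart-≤ (suc k) 1                   = z≤n
blockStart-≤ (suc k) 2                   = z≤n
blockStart-≤ (suc k) (suc (suc (suc i))) = s≤s (s≤s (s≤s (blockStart-≤ k i)))

≤-blockStart : ∀ k i → i ≤ 2 + blockStart k i
≤-blockStart zero    i                   = ℕ.m≤n+m i 2
≤-blockStart (suc k) 0                   = z≤n
≤-blockStart (suc k) 1                   = s≤s z≤n
≤-blockStart (suc k) 2                   = s≤s (s≤s z≤n)
≤-blockStart (suc k) (suc (suc (suc i))) = s≤s (s≤s (s≤s (≤-blockStart k i)))

blockStart-mono : ∀ k {i j} → i ≤ j → blockStart k i ≤ blockStart k j
blockStart-mono zero    i≤j                           = i≤j
blockStart-mono (suc k) {0}                       _   = z≤n
blockStart-mono (suc k) {1}                       _   = z≤n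
blockStart-mono (suc k) {2}                       _   = z≤n
blockStart-mono (suc k) {suc (suc (suc i))} (s≤s (s≤s (s≤s i≤j))) = s≤s (s≤s (s≤s (blockStart-mono k i≤j)))

InWindow : ℕ → ∀ {n} → Fin n → Set
InWindow c x = c ≤ toℕ x × toℕ x ≤ 2 + c

no-four-in-window : ∀ {c p q r s} → c ≤ p → s ≤ 2 + c → p < q → q < r → r < s → ⊥
no-four-in-window c≤p s≤2+c p<q q<r r<s = ℕ.1+n≰n
  (ℕ.≤-trans (s≤s (s≤s (s≤s c≤p))) (ℕ.≤-trans (s≤s (s≤s p<q)) (ℕ.≤-trans (s≤s q<r) (ℕ.≤-trans r<s s≤2+c))))

intervals-meet : ∀ {n c} {p q r s : Fin n} → InWindow c p → InWindow c q → InWindow c r → InWindow c s →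
  p <ᶠ q → r <ᶠ s → ¬ DisjointIntervals p q r s
intervals-meet {p = p} {q} {r} {s} (c≤p , _) (_ , q≤2+c) (c≤r , _) (_ , s≤2+c) p<q r<s disjoint
  with ℕ.≤-total (toℕ p) (toℕ r)
... | inj₁ p≤r with toℕ r ℕ.≤? toℕ q
...   | yes r≤q = disjoint (r , (p≤r , r≤q) , (ℕ.≤-refl , ℕ.<⇒≤ r<s))
...   | no  r≰q = no-four-in-window c≤p s≤2+c p<q (ℕ.≰⇒> r≰q) r<s
intervals-meet {p = p} {q} {r} {s} (c≤p , _) (_ , q≤2+c) (c≤r , _) (_ , s≤2+c) p<q r<s disjoint
    | inj₂ r≤p with toℕ p ℕ.≤? toℕ s
...   | yes p≤s = disjoint (p , (ℕ.≤-refl , ℕ.<⇒≤ p<q) , (r≤p , p≤s))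
...   | no  p≰s = no-four-in-window c≤r q≤2+c r<s (ℕ.≰⇒> p≰s) p<q

PreservesBlocks : ℕ → ∀ {n} → (Fin n → Fin n) → Set
PreservesBlocks k f = ∀ i → blockStart k (toℕ (f i)) ≡ blockStart k (toℕ i)

-- Monotonicity of blockStart forces the four positions of a and b into one block of width 3.
sameBlocks⇒¬LocallyParallel : ∀ k {n} {σ τ : Permutation′ n} (h : Fin n → Fin n) →
  PreservesBlocks k h → (∀ a → pos τ a ≡ h (pos σ a)) → ¬ LocallyParallel σ τ
sameBlocks⇒¬LocallyParallel k {σ = σ} {τ} h h-blocks τ≡hσ (a , b , _ , p<q , r<s , disjoint) =
  intervals-meet (window p refl) (window q q-block) (window r (trans r-block q-block)) (window s s-block)
    p<q r<s disjoint
  where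
  block : Fin _ → ℕ
  block = blockStart k ∘ toℕ
  p = pos σ a
  q = pos σ b
  r = pos τ b
  s = pos τ a
  r-block : block r ≡ block q
  r-block = trans (cong block (τ≡hσ b)) (h-blocks q)
  s-block : block s ≡ block p
  s-block = trans (cong block (τ≡hσ a)) (h-blocks p)
  q-block : block q ≡ block p
  q-block = ℕ.≤-antisym (subst₂ _≤_ r-block s-block (blockStart-mono k (ℕ.<⇒≤ r<s)))
                        (blockStart-mono k (ℕ.<⇒≤ p<q))
  window : ∀ x → block x ≡ block p → InWindow (block p) x
  window x eq = subst (_≤ toℕ x) eq (blockStart-≤ k _) , subst (λ c → toℕ x ≤ 2 + c) eq (≤-blockStart k _)

blockCosets⇒¬LocallyParallel : ∀ k {n} {σ τ β β′ : Permutation′ n} →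
  PreservesBlocks k (β ⟨$⟩ʳ_) → PreservesBlocks k (β′ ⟨$⟩ʳ_) →
  β ∘ₚ σ ≈ β′ ∘ₚ τ → ¬ LocallyParallel σ τ
blockCosets⇒¬LocallyParallel k {σ = σ} {τ} {β} {β′} β-blocks β′-blocks eq = sameBlocks⇒¬LocallyParallel k {σ = σ} {τ} h h-blocks τ≡hσ
  where
  h : Fin _ → Fin _
  h y = β′ ⟨$⟩ʳ (β ⟨$⟩ˡ y)
  h-blocks : PreservesBlocks k h
  h-blocks y = trans (β′-blocks (β ⟨$⟩ˡ y))
    (trans (sym (β-blocks (β ⟨$⟩ˡ y))) (cong (blockStart k ∘ toℕ) (inverseʳ β)))
  τ≡hσ : ∀ a → pos τ a ≡ h (pos σ a)
  τ≡hσ a = begin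
    τ ⟨$⟩ˡ a                                              ≡⟨ cong (τ ⟨$⟩ˡ_) (trans (sym (inverseʳ σ)) (cong (σ ⟨$⟩ʳ_) (sym (inverseʳ β)))) ⟩
    τ ⟨$⟩ˡ (σ ⟨$⟩ʳ (β ⟨$⟩ʳ (β ⟨$⟩ˡ (σ ⟨$⟩ˡ a))))          ≡⟨ cong (τ ⟨$⟩ˡ_) (eq (β ⟨$⟩ˡ (σ ⟨$⟩ˡ a))) ⟩
    τ ⟨$⟩ˡ (τ ⟨$⟩ʳ h (σ ⟨$⟩ˡ a))                          ≡⟨ inverseˡ τ ⟩
    h (σ ⟨$⟩ˡ a)                                          ∎
    where open ≡-Reasoning

_⊕_ : ∀ {l m} → Permutation′ l → Permutation′ m → Permutation′ (l + m)
π ⊕ ρ = ↔-trans +↔⊎ (↔-trans (π ⊎-↔ ρ) (↔-sym +↔⊎))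

⊕-↑ˡ : ∀ {l m} (π : Permutation′ l) (ρ : Permutation′ m) i → (π ⊕ ρ) ⟨$⟩ʳ (i ↑ˡ m) ≡ (π ⟨$⟩ʳ i) ↑ˡ m
⊕-↑ˡ {l} {m} π ρ i = cong (join l m ∘ Sum.map (π ⟨$⟩ʳ_) (ρ ⟨$⟩ʳ_)) (splitAt-↑ˡ l i m)

⊕-↑ʳ : ∀ {l m} (π : Permutation′ l) (ρ : Permutation′ m) j → (π ⊕ ρ) ⟨$⟩ʳ (l ↑ʳ j) ≡ l ↑ʳ (ρ ⟨$⟩ʳ j)
⊕-↑ʳ {l} {m} π ρ j = cong (join l m ∘ Sum.map (π ⟨$⟩ʳ_) (ρ ⟨$⟩ʳ_)) (splitAt-↑ʳ l m j)

⊕-injective : ∀ {l m} (π π′ : Permutation′ l) (ρ ρ′ : Permutation′ m) → π ⊕ ρ ≈ π′ ⊕ ρ′ → π ≈ π′ × ρ ≈ ρ′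
⊕-injective {l} {m} π π′ ρ ρ′ eq =
  (λ i → ↑ˡ-injective m _ _ (trans (sym (⊕-↑ˡ π ρ i)) (trans (eq (i ↑ˡ m)) (⊕-↑ˡ π′ ρ′ i)))) ,
  (λ j → ↑ʳ-injective l _ _ (trans (sym (⊕-↑ʳ π ρ j)) (trans (eq (l ↑ʳ j)) (⊕-↑ʳ π′ ρ′ j))))

blockPerm : ∀ k {n} → k * 3 ≤ n → (Fin k → Permutation′ 3) → Permutation′ n
blockPerm zero    _                         πs = id
blockPerm (suc k) (s≤s (s≤s (s≤s k*3≤n))) πs = πs zero ⊕ blockPerm k k*3≤n (πs ∘ suc)

blockStart-firstBlock : ∀ k {n} (x : Fin 3) → blockStart (suc k) (toℕ (x ↑ˡ n)) ≡ 0
blockStart-firstBlock k 0F = refl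
blockStart-firstBlock k 1F = refl
blockStart-firstBlock k 2F = refl

blockPerm-preserves : ∀ k {n} (k*3≤n : k * 3 ≤ n) πs → PreservesBlocks k (blockPerm k k*3≤n πs ⟨$⟩ʳ_)
blockPerm-preserves zero    _                         πs i                 = refl
blockPerm-preserves (suc k) (s≤s (s≤s (s≤s k*3≤n))) πs 0F                = blockStart-firstBlock k (πs zero ⟨$⟩ʳ 0F)
blockPerm-preserves (suc k) (s≤s (s≤s (s≤s k*3≤n))) πs 1F                = blockStart-firstBlock k (πs zero ⟨$⟩ʳ 1F)
blockPerm-preserves (suc k) (s≤s (s≤s (s≤s k*3≤n))) πs 2F                = blockStart-firstBlock k (πs zero ⟨$⟩ʳ 2F)
blockPerm-preserves (suc k) (s≤s (s≤s (s≤s k*3≤n))) πs (suc (suc (suc j))) =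
  cong (3 +_) (blockPerm-preserves k k*3≤n (πs ∘ suc) j)

blockPerm-injective : ∀ k {n} (k*3≤n : k * 3 ≤ n) πs πs′ →
  blockPerm k k*3≤n πs ≈ blockPerm k k*3≤n πs′ → ∀ i → πs i ≈ πs′ i
blockPerm-injective (suc k) (s≤s (s≤s (s≤s k*3≤n))) πs πs′ eq i
  with ⊕-injective (πs zero) (πs′ zero) (blockPerm k k*3≤n (πs ∘ suc)) (blockPerm k k*3≤n (πs′ ∘ suc)) eq
... | head-eq , tail-eq with i
...   | zero  = head-eq
...   | suc i = blockPerm-injective k k*3≤n (πs ∘ suc) (πs′ ∘ suc) tail-eq i

blocks : ∀ k {n} → k * 3 ≤ n → Fin (6 ^ k) → Permutation′ n
blocks k k*3≤n c = blockPerm k k*3≤n (fromCode 3 ∘ finToFun c)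

blocks-injective : ∀ k {n} (k*3≤n : k * 3 ≤ n) {c d} → blocks k k*3≤n c ≈ blocks k k*3≤n d → c ≡ d
blocks-injective k k*3≤n eq = finToFun-injective (λ i → fromCode-injective (blockPerm-injective k k*3≤n _ _ eq i))

LPFamily⇒length*6^k≤n! : ∀ k {n} → k * 3 ≤ n → (S : List (Permutation′ n)) → LPFamily n S → length S * 6 ^ k ≤ n !
LPFamily⇒length*6^k≤n! k {n} k*3≤n S family =
  injective⇒≤! (uncurry shifted ∘ remQuot {length S} (6 ^ k))
    (remQuot-injective {length S} (6 ^ k) ∘ shifted-injective)
  where
  shifted : Fin (length S) → Fin (6 ^ k) → Permutation′ n
  shifted i c = blocks k k*3≤n c ∘ₚ lookup S i
  shifted-injective : ∀ {x y} → uncurry shifted x ≈ uncurry shifted y → x ≡ y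
  shifted-injective {i , c} {j , d} eq = decide (i ≟ j)
    where
    decide : Dec (i ≡ j) → (i , c) ≡ (j , d)
    σ = lookup S i
    decide (yes i≡j) = cong₂ _,_ i≡j (blocks-injective k k*3≤n {c} {d} λ x → ⟨$⟩ʳ-injective σ (begin
      σ ⟨$⟩ʳ (blocks k k*3≤n c ⟨$⟩ʳ x)            ≡⟨ eq x ⟩
      lookup S j ⟨$⟩ʳ (blocks k k*3≤n d ⟨$⟩ʳ x)   ≡⟨ cong (λ l → lookup S l ⟨$⟩ʳ (blocks k k*3≤n d ⟨$⟩ʳ x)) i≡j ⟨
      σ ⟨$⟩ʳ (blocks k k*3≤n d ⟨$⟩ʳ x)            ∎))
      where open ≡-Reasoning
    decide (no  i≢j) = contradiction (proj₂ (AllPairs-lookup (λ {σ} {τ} → DistinctLP-sym {n} {σ} {τ}) family i≢j))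
      (blockCosets⇒¬LocallyParallel k {σ = lookup S i} {lookup S j} {blocks k k*3≤n c} {blocks k k*3≤n d}
        (blockPerm-preserves k k*3≤n (fromCode 3 ∘ finToFun c))
        (blockPerm-preserves k k*3≤n (fromCode 3 ∘ finToFun d)) eq)

-- The lower bound: permutations whose inversions overlap

module _ {n} (ω : Permutation′ n) where

  InversionsOverlap : Set
  InversionsOverlap = ∀ {i j} → i <ᶠ j → ω ⟨$⟩ʳ j <ᶠ ω ⟨$⟩ʳ i → ω ⟨$⟩ʳ j ≤ᶠ j × i ≤ᶠ ω ⟨$⟩ʳ i

  IsLeftMax : Fin n → Set
  IsLeftMax i = ∀ j → j <ᶠ i → ω ⟨$⟩ʳ j <ᶠ ω ⟨$⟩ʳ i

  isLeftMax? : ∀ i → Dec (IsLeftMax i)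
  isLeftMax? i = all? λ j → (j <? i) →-dec (ω ⟨$⟩ʳ j <? ω ⟨$⟩ʳ i)

LocallyParallel-atPositions : ∀ {n} (τ σ : Permutation′ n) {i j} → i <ᶠ j →
  pos σ (τ ⟨$⟩ʳ j) <ᶠ pos σ (τ ⟨$⟩ʳ i) → DisjointIntervals i j (pos σ (τ ⟨$⟩ʳ j)) (pos σ (τ ⟨$⟩ʳ i)) →
  LocallyParallel τ σ
LocallyParallel-atPositions τ σ {i} {j} i<j σ-ba disjoint =
  τ ⟨$⟩ʳ i , τ ⟨$⟩ʳ j , <⇒≢ i<j ∘ ⟨$⟩ʳ-injective τ ,
  subst₂ _<ᶠ_ (sym (inverseˡ τ)) (sym (inverseˡ τ)) i<j , σ-ba ,
  subst₂ (λ p q → DisjointIntervals p q (pos σ (τ ⟨$⟩ʳ j)) (pos σ (τ ⟨$⟩ʳ i))) (sym (inverseˡ τ)) (sym (inverseˡ τ)) disjoint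

¬LocallyParallel⇒InversionsOverlap : ∀ {n} (τ σ : Permutation′ n) → ¬ LocallyParallel τ σ → InversionsOverlap (τ ∘ₚ flip σ)
¬LocallyParallel⇒InversionsOverlap τ σ ¬lp {i} {j} i<j inversion
  with toℕ (pos σ (τ ⟨$⟩ʳ j)) ℕ.≤? toℕ j | toℕ i ℕ.≤? toℕ (pos σ (τ ⟨$⟩ʳ i))
... | yes ωj≤j | yes i≤ωi = ωj≤j , i≤ωi
... | no  ωj≰j | _        = ⊥-elim (¬lp (LocallyParallel-atPositions τ σ i<j inversion
  λ (k , (_ , k≤j) , (ωj≤k , _)) → ωj≰j (ℕ.≤-trans ωj≤k k≤j)))
... | yes _    | no  i≰ωi = ⊥-elim (¬lp (LocallyParallel-atPositions τ σ i<j inversion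
  λ (k , (i≤k , _) , (_ , k≤ωi)) → i≰ωi (ℕ.≤-trans i≤k k≤ωi)))

data Label : Set where
  fixed leftMax other : Label

isLeftMaxLabel : Label → Bool
isLeftMaxLabel leftMax = true
isLeftMaxLabel _       = false

isLeftMaxLabel-true : ∀ {l} → isLeftMaxLabel l ≡ true → l ≡ leftMax
isLeftMaxLabel-true {leftMax} _ = refl
isLeftMaxLabel-true {fixed}   ()
isLeftMaxLabel-true {other}   ()

module _ {n} (ω : Permutation′ n) where

  label : Fin n → Label
  label i with ω ⟨$⟩ʳ i ≟ i | isLeftMax? ω i
  ... | yes _ | _     = fixed
  ... | no  _ | yes _ = leftMax
  ... | no  _ | no  _ = other

  LabelMeaning : Fin n → Label → Set
  LabelMeaning i fixed   = ω ⟨$⟩ʳ i ≡ i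
  LabelMeaning i leftMax = IsLeftMax ω i
  LabelMeaning i other   = ω ⟨$⟩ʳ i ≢ i × ¬ IsLeftMax ω i

  label-meaning : ∀ i → LabelMeaning i (label i)
  label-meaning i with ω ⟨$⟩ʳ i ≟ i | isLeftMax? ω i
  ... | yes ωi≡i | _          = ωi≡i
  ... | no  _    | yes max    = max
  ... | no  ωi≢i | no  ¬max   = ωi≢i , ¬max

  meaning : ∀ {i l} → label i ≡ l → LabelMeaning i l
  meaning {i} refl = label-meaning i

  valueLabel : Fin n → Bool
  valueLabel v = isLeftMaxLabel (label (ω ⟨$⟩ˡ v))

  mark : Fin n → Label × Bool
  mark i = label i , valueLabel i

valueLabel-leftMax : ∀ {n} (ω : Permutation′ n) i → label ω i ≡ leftMax → valueLabel ω (ω ⟨$⟩ʳ i) ≡ true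
valueLabel-leftMax ω i eq = cong isLeftMaxLabel (trans (cong (label ω) (inverseˡ ω)) eq)

label-zero : ∀ {m} (ω : Permutation′ (suc m)) → label ω zero ≢ other
label-zero ω eq = proj₂ (meaning ω eq) λ _ ()

other⇒rightMin : ∀ {n} (ω : Permutation′ n) → InversionsOverlap ω → ∀ {i} → LabelMeaning ω i other →
  ∀ {k} → i <ᶠ k → ω ⟨$⟩ʳ i ≤ᶠ ω ⟨$⟩ʳ k
other⇒rightMin {n} ω overlaps {i} (ωi≢i , ¬max) i<k =
  ℕ.≮⇒≥ λ ωk<ωi → ℕ.<⇒≱ ωi<i (proj₂ (overlaps i<k ωk<ωi))
  where
  witness : ∃ λ j → ¬ (j <ᶠ i → ω ⟨$⟩ʳ j <ᶠ ω ⟨$⟩ʳ i)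
  witness = ¬∀⟶∃¬ n _ (λ j → (j <? i) →-dec (ω ⟨$⟩ʳ j <? ω ⟨$⟩ʳ i)) ¬max
  j = proj₁ witness
  j<i : j <ᶠ i
  j<i = decidable-stable (j <? i) λ j≮i → proj₂ witness λ j<i → contradiction j<i j≮i
  ωi<ωj : ω ⟨$⟩ʳ i <ᶠ ω ⟨$⟩ʳ j
  ωi<ωj = ℕ.≤∧≢⇒< (ℕ.≮⇒≥ λ ωj<ωi → proj₂ witness λ _ → ωj<ωi)
                  (λ eq → <⇒≢ j<i (sym (⟨$⟩ʳ-injective ω (toℕ-injective eq))))
  ωi<i : ω ⟨$⟩ʳ i <ᶠ i
  ωi<i = ℕ.≤∧≢⇒< (proj₁ (overlaps j<i ωi<ωj)) (ωi≢i ∘ toℕ-injective)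

-- If ω and ω′ agree below i but ω i < ω′ i, the value ω i sits in ω′ at a position j > i;
-- the common label of i then yields a contradiction.
agreeBelow-¬< : ∀ {n} (ω ω′ : Permutation′ n) → InversionsOverlap ω′ → (∀ i → mark ω i ≡ mark ω′ i) →
  ∀ i → (∀ {j} → j <ᶠ i → ω ⟨$⟩ʳ j ≡ ω′ ⟨$⟩ʳ j) → ¬ (ω ⟨$⟩ʳ i <ᶠ ω′ ⟨$⟩ʳ i)
agreeBelow-¬< ω ω′ overlaps′ same i agree ωi<ω′i with <-cmp (ω′ ⟨$⟩ˡ (ω ⟨$⟩ʳ i)) i
... | tri< j<i _ _ = <⇒≢ j<i (⟨$⟩ʳ-injective ω (trans (agree j<i) (inverseʳ ω′)))
... | tri≈ _ j≡i _ = <⇒≢ ωi<ω′i (trans (sym (inverseʳ ω′)) (cong (ω′ ⟨$⟩ʳ_) j≡i))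
... | tri> _ _ i<j = by-label (label ω i) refl
  where
  j = ω′ ⟨$⟩ˡ (ω ⟨$⟩ʳ i)
  same-label : label ω i ≡ label ω′ i
  same-label = cong proj₁ (same i)
  by-label : ∀ l → label ω i ≡ l → ⊥
  by-label fixed   eq = <⇒≢ ωi<ω′i (trans (meaning ω eq) (sym (meaning ω′ (trans (sym same-label) eq))))
  by-label leftMax eq = <-asym ωi<ω′i (subst (ω′ ⟨$⟩ʳ i <ᶠ_) (inverseʳ ω′) (meaning ω′ j-leftMax i i<j))
    where
    j-leftMax : label ω′ j ≡ leftMax
    j-leftMax = isLeftMaxLabel-true (trans (sym (cong proj₂ (same (ω ⟨$⟩ʳ i)))) (valueLabel-leftMax ω i eq))
  by-label other   eq = ℕ.<⇒≱ ωi<ω′i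
    (subst (ω′ ⟨$⟩ʳ i ≤ᶠ_) (inverseʳ ω′) (other⇒rightMin ω′ overlaps′ (meaning ω′ (trans (sym same-label) eq)) i<j))

marks-determine : ∀ {n} (ω ω′ : Permutation′ n) → InversionsOverlap ω → InversionsOverlap ω′ →
  (∀ i → mark ω i ≡ mark ω′ i) → ω ≈ ω′
marks-determine ω ω′ overlaps overlaps′ same = WF.All.wfRec <-wellFounded 0ℓ _ step
  where
  step : ∀ i → (∀ {j} → j <ᶠ i → ω ⟨$⟩ʳ j ≡ ω′ ⟨$⟩ʳ j) → ω ⟨$⟩ʳ i ≡ ω′ ⟨$⟩ʳ i
  step i agree with <-cmp (ω ⟨$⟩ʳ i) (ω′ ⟨$⟩ʳ i)
  ... | tri< lt _ _ = contradiction lt (agreeBelow-¬< ω ω′ overlaps′ same i agree)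
  ... | tri≈ _ eq _ = eq
  ... | tri> _ _ gt = contradiction gt (agreeBelow-¬< ω′ ω overlaps (sym ∘ same) i (sym ∘ agree))

encode : Label × Bool → Fin 6
encode (fixed   , false) = 0F
encode (fixed   , true)  = 1F
encode (leftMax , false) = 2F
encode (leftMax , true)  = 3F
encode (other   , false) = 4F
encode (other   , true)  = 5F

decode : Fin 6 → Label × Bool
decode 0F = fixed   , false
decode 1F = fixed   , true
decode 2F = leftMax , false
decode 3F = leftMax , true
decode 4F = other   , false
decode 5F = other   , true

decode-encode : ∀ x → decode (encode x) ≡ x
decode-encode (fixed   , false) = refl
decode-encode (fixed   , true)  = refl
decode-encode (leftMax , false) = refl
decode-encode (leftMax , true)  = refl
decode-encode (other   , false) = refl
decode-encode (other   , true)  = refl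

-- Position 0 is vacuously a left-to-right maximum, so its label is never other: 4 codes
-- suffice there, which is what makes the lower bound strict.
encode₀ : Label × Bool → Fin 4
encode₀ (fixed   , false) = 0F
encode₀ (fixed   , true)  = 1F
encode₀ (leftMax , false) = 2F
encode₀ (leftMax , true)  = 3F
encode₀ (other   , _)     = 0F

decode-encode₀ : ∀ {l} b → l ≢ other → decode (encode₀ (l , b) ↑ˡ 2) ≡ (l , b)
decode-encode₀ {fixed}   false _ = refl
decode-encode₀ {fixed}   true  _ = refl
decode-encode₀ {leftMax} false _ = refl
decode-encode₀ {leftMax} true  _ = refl
decode-encode₀ {other}   _     l≢other = contradiction refl l≢other

signature : ∀ {m} → Permutation′ (suc m) → Fin (4 * 6 ^ m)
signature ω = combine (encode₀ (mark ω zero)) (funToFin (encode ∘ mark ω ∘ suc))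

signature-injective : ∀ {m} (ω ω′ : Permutation′ (suc m)) → signature ω ≡ signature ω′ →
  ∀ i → mark ω i ≡ mark ω′ i
signature-injective ω ω′ eq = same-marks
  where
  open ≡-Reasoning
  marks = encode ∘ mark ω ∘ suc
  marks′ = encode ∘ mark ω′ ∘ suc
  head-eq : encode₀ (mark ω zero) ≡ encode₀ (mark ω′ zero)
  head-eq = combine-injectiveˡ (encode₀ (mark ω zero)) (funToFin marks) (encode₀ (mark ω′ zero)) (funToFin marks′) eq
  tail-eq : funToFin marks ≡ funToFin marks′
  tail-eq = combine-injectiveʳ (encode₀ (mark ω zero)) (funToFin marks) (encode₀ (mark ω′ zero)) (funToFin marks′) eq
  same-marks : ∀ i → mark ω i ≡ mark ω′ i
  same-marks zero = begin
    mark ω zero                             ≡⟨ decode-encode₀ _ (label-zero ω) ⟨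
    decode (encode₀ (mark ω zero) ↑ˡ 2)     ≡⟨ cong (decode ∘ (_↑ˡ 2)) head-eq ⟩
    decode (encode₀ (mark ω′ zero) ↑ˡ 2)    ≡⟨ decode-encode₀ _ (label-zero ω′) ⟩
    mark ω′ zero                            ∎
  same-marks (suc i) = begin
    mark ω (suc i)                          ≡⟨ decode-encode _ ⟨
    decode (marks i)                        ≡⟨ cong decode (finToFun-funToFin marks i) ⟨
    decode (finToFun (funToFin marks) i)    ≡⟨ cong (λ c → decode (finToFun c i)) tail-eq ⟩
    decode (finToFun (funToFin marks′) i)   ≡⟨ cong decode (finToFun-funToFin marks′ i) ⟩
    decode (marks′ i)                       ≡⟨ decode-encode _ ⟩
    mark ω′ (suc i)                         ∎

-- τ is recovered from the index of some σ ∈ S not locally parallel to it and the signature of σ⁻¹ ∘ τ.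
dominating⇒n!≤length*4*6^m : ∀ {m} (S : List (Permutation′ (suc m))) → (∀ τ → Any (λ σ → ¬ LocallyParallel τ σ) S) →
  suc m ! ≤ length S * (4 * 6 ^ m)
dominating⇒n!≤length*4*6^m {m} S dominated = injective⇒!≤ code (λ {τ} {τ′} → code-injective {τ} {τ′} (witness τ) (witness τ′))
  where
  Witness : Permutation′ (suc m) → Set
  Witness τ = Σ (Fin (length S)) λ k → ¬ LocallyParallel τ (lookup S k)
  witness : ∀ τ → Witness τ
  witness τ = index (dominated τ) , lookup-index (dominated τ)
  codeWith : ∀ τ → Witness τ → Fin (length S * (4 * 6 ^ m))
  codeWith τ (k , _) = combine k (signature (τ ∘ₚ flip (lookup S k)))
  code : Permutation′ (suc m) → Fin (length S * (4 * 6 ^ m))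
  code τ = codeWith τ (witness τ)
  code-injective : ∀ {τ τ′} (w : Witness τ) (w′ : Witness τ′) → codeWith τ w ≡ codeWith τ′ w′ → τ ≈ τ′
  code-injective {τ} {τ′} (k , ¬lp) (k′ , ¬lp′) eq
    with refl ← combine-injectiveˡ k (signature (τ ∘ₚ flip (lookup S k))) k′ (signature (τ′ ∘ₚ flip (lookup S k′))) eq
    = λ x → trans (sym (inverseʳ σ)) (trans (cong (σ ⟨$⟩ʳ_) (ω≈ω′ x)) (inverseʳ σ))
    where
    σ = lookup S k
    ω≈ω′ : τ ∘ₚ flip σ ≈ τ′ ∘ₚ flip σ
    ω≈ω′ = marks-determine (τ ∘ₚ flip σ) (τ′ ∘ₚ flip σ)
      (¬LocallyParallel⇒InversionsOverlap τ σ ¬lp) (¬LocallyParallel⇒InversionsOverlap τ′ σ ¬lp′)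
      (signature-injective (τ ∘ₚ flip σ) (τ′ ∘ₚ flip σ)
        (combine-injectiveʳ k (signature (τ ∘ₚ flip σ)) k (signature (τ′ ∘ₚ flip σ)) eq))

≤-*4⇒<-*6 : ∀ {a p} K .{{_ : NonZero K}} → 0 < a → a ≤ p * (4 * K) → a < p * (6 * K)
≤-*4⇒<-*6 {p = zero}  K 0<a a≤0 = contradiction a≤0 (ℕ.<⇒≱ 0<a)
≤-*4⇒<-*6 {p = suc p} K _   a≤  = ℕ.≤-<-trans a≤ (ℕ.*-monoʳ-< (suc p) (ℕ.*-monoˡ-< K {4} {6} (s≤s (s≤s (s≤s (s≤s (s≤s z≤n)))))))

theorem3 : (n : ℕ) → 1 ≤ n →
    Σ ℕ λ p → IsP n p × (n ! < p * 6 ^ n) × (p * 6 ^ (n / 3) ≤ n !)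
theorem3 (suc m) _ with maximumLPFamily (suc m)
... | p , isP@((S , family , refl) , maximal) = length S , isP , lower , upper
  where
  instance 6^m≢0 = ℕ.m^n≢0 6 m
  lower : suc m ! < length S * 6 ^ suc m
  lower = ≤-*4⇒<-*6 {p = length S} (6 ^ m) (ℕ.1≤n! (suc m)) (dominating⇒n!≤length*4*6^m S (maximum⇒dominating family maximal))
  upper : length S * 6 ^ (suc m / 3) ≤ suc m !
  upper = LPFamily⇒length*6^k≤n! (suc m / 3) (m/n*n≤m (suc m) 3) S family
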